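{- Let $G$ be a graph with no isolated vertices. For every $uv\in E(\overline{G})$, $\gamma_{tR}(G)-2\leq\gamma_{tR}(G+uv)\leq\gamma_{tR}(G)$.
   Context: All graphs are finite and simple. For a graph $G$ with no isolated vertices, a total Roman dominating function is a map $f:V(G)\to\{0,1,2\}$ such that every vertex with $f(v)=0$ is adjacent to a vertex $u$ with $f(u)=2$, and the subgraph induced by $\{v:f(v)>0\}$ has no isolated vertices; $\gamma_{tR}(G)$ is the minimum of $\sum_v f(v)$ over such $f$. -}

module Defs where

open import Data.Nat using (ℕ; _+_; _≤_; _>_)
open import Data.Fin using (Fin; toℕ; _≟_)
open import Data.Bool using (Bool; true; false; _∨_; _∧_)
open import Data.List using (allFin; map)
open import Data.Nat.ListAction using (sum)
open import Data.Product using (Σ; ∃; _×_)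
open import Relation.Nullary.Decidable using (⌊_⌋)
open import Relation.Binary.PropositionalEquality using (_≡_)

record Graph (n : ℕ) : Set where
  field
    adj     : Fin n → Fin n → Bool
    adj-sym : ∀ x y → adj x y ≡ adj y x
    adj-irr : ∀ x → adj x x ≡ false
open Graph public

NoIsolated : ∀ {n} → Graph n → Set
NoIsolated {n} G = ∀ (v : Fin n) → ∃ λ (w : Fin n) → adj G v w ≡ true

addEdgeAdj : ∀ {n} → Graph n → Fin n → Fin n → Fin n → Fin n → Bool
addEdgeAdj G u v x y =
  adj G x y ∨ (⌊ x ≟ u ⌋ ∧ ⌊ y ≟ v ⌋) ∨ (⌊ x ≟ v ⌋ ∧ ⌊ y ≟ u ⌋)

weight : ∀ {n} → (Fin n → Fin 3) → ℕ
weight {n} f = sum (map (λ v → toℕ (f v)) (allFin n))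

record IsTRDF {n} (G : Graph n) (f : Fin n → Fin 3) : Set where
  field
    dom   : ∀ v → toℕ (f v) ≡ 0 →
            ∃ λ u → adj G v u ≡ true × toℕ (f u) ≡ 2
    total : ∀ v → toℕ (f v) > 0 →
            ∃ λ u → adj G v u ≡ true × toℕ (f u) > 0

IsTRDomNumber : ∀ {n} → Graph n → ℕ → Set
IsTRDomNumber {n} G k =
  (Σ (Fin n → Fin 3) λ f → IsTRDF G f × weight f ≡ k) ×
  (∀ (f : Fin n → Fin 3) → IsTRDF G f → k ≤ weight f)

-- A TRDF of G is a TRDF of G + uv, which gives γ_tR(G + uv) ≤ γ_tR(G).
-- Conversely, a TRDF g of G + uv fails to be one of G only where an
-- endpoint relies on the new edge: u labelled 0 with v labelled 2 (or vice
-- versa), or u and v both positive.  Raising one G-neighbour of u to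
-- label 2 in the first case, or one G-neighbour of each endpoint to
-- label ≥ 1 in the second, repairs g at a cost of at most 2.
module Submission where

open import Defs
open import Data.Nat using (ℕ; _+_; _≤_; _<_; z≤n; s≤s)
import Data.Nat.Properties as ℕ
open import Data.Fin using (Fin; zero; suc; toℕ; _≟_) renaming (_≤_ to _≤ᶠ_)
import Data.Fin.Properties as Fin
open import Data.Bool using (true; false)
open import Data.Product using (_×_; _,_; Σ; ∃; proj₁; proj₂)
open import Data.Sum using (_⊎_; inj₁; inj₂)
open import Data.List using (tabulate)
open import Data.List.Properties using (map-tabulate)
open import Data.Nat.ListAction using (sum)
open import Data.Vec.Functional using (Vector; updateAt)
open import Data.Vec.Functional.Properties using (updateAt-updates)
open import Relation.Nullary using (¬_; yes; no)
open import Relation.Binary.PropositionalEquality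
open import Function using (id; _∘_)

private
  variable
    n : ℕ

record AddsEdge (G : Graph n) (u v : Fin n) (G′ : Graph n) : Set where
  constructor addsEdge
  field adj-addEdge : ∀ x y → adj G′ x y ≡ addEdgeAdj G u v x y

module _ {G G′ : Graph n} {u v : Fin n} (G′≡G+uv : AddsEdge G u v G′) where
  open AddsEdge G′≡G+uv

  addEdge-⊇ : ∀ {x y} → adj G x y ≡ true → adj G′ x y ≡ true
  addEdge-⊇ {x} {y} xy∈G rewrite adj-addEdge x y | xy∈G = refl

  addEdge-cases : ∀ {x y} → adj G′ x y ≡ true →
                  adj G x y ≡ true ⊎ (x ≡ u × y ≡ v) ⊎ (x ≡ v × y ≡ u)
  addEdge-cases {x} {y} xy∈G′ = cases (trans (sym (adj-addEdge x y)) xy∈G′)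
    where
    cases : addEdgeAdj G u v x y ≡ true →
            adj G x y ≡ true ⊎ (x ≡ u × y ≡ v) ⊎ (x ≡ v × y ≡ u)
    cases e with adj G x y | x ≟ u | y ≟ v | x ≟ v | y ≟ u
    cases e  | true  | _     | _     | _     | _     = inj₁ refl
    cases e  | false | yes p | yes q | _     | _     = inj₂ (inj₁ (p , q))
    cases e  | false | yes _ | no _  | yes p | yes q = inj₂ (inj₂ (p , q))
    cases () | false | yes _ | no _  | yes _ | no _
    cases () | false | yes _ | no _  | no _  | _
    cases e  | false | no _  | _     | yes p | yes q = inj₂ (inj₂ (p , q))
    cases () | false | no _  | _     | yes _ | no _
    cases () | false | no _  | _     | no _  | _

IsTRDF-⊆ : {G G′ : Graph n} → (∀ {x y} → adj G x y ≡ true → adj G′ x y ≡ true) →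
           ∀ {f} → IsTRDF G f → IsTRDF G′ f
IsTRDF-⊆ G⊆G′ f-trdf = record
  { dom   = λ x fx≡0 → let y , xy , fy≡2 = IsTRDF.dom f-trdf x fx≡0 in y , G⊆G′ xy , fy≡2
  ; total = λ x fx>0 → let y , xy , fy>0 = IsTRDF.total f-trdf x fx>0 in y , G⊆G′ xy , fy>0
  }

label≡2-mono : ∀ {a b : Fin 3} → a ≤ᶠ b → toℕ a ≡ 2 → toℕ b ≡ 2
label≡2-mono {b = b} a≤b a≡2 = ℕ.≤-antisym (Fin.toℕ≤pred[n] b) (subst (_≤ toℕ b) a≡2 a≤b)

-- Whatever the edge xy does for x under the labelling g, some G-neighbour of x does under f.
record Compensates (G : Graph n) (g f : Fin n → Fin 3) (x y : Fin n) : Set where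
  field
    dom   : toℕ (g x) ≡ 0 → toℕ (g y) ≡ 2 → ∃ λ w → adj G x w ≡ true × toℕ (f w) ≡ 2
    total : 0 < toℕ (g x) → 0 < toℕ (g y) → ∃ λ w → adj G x w ≡ true × 0 < toℕ (f w)

module _ {G : Graph n} {g : Fin n → Fin 3} where

  compensates-mono : ∀ {f f′ x y} → (∀ w → f w ≤ᶠ f′ w) →
                     Compensates G g f x y → Compensates G g f′ x y
  compensates-mono f≤f′ c = record
    { dom   = λ gx≡0 gy≡2 → let w , xw , fw≡2 = Compensates.dom c gx≡0 gy≡2
                            in w , xw , label≡2-mono (f≤f′ w) fw≡2
    ; total = λ gx>0 gy>0 → let w , xw , fw>0 = Compensates.total c gx>0 gy>0
                            in w , xw , ℕ.<-≤-trans fw>0 (f≤f′ w)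
    }

  compensates-edge : ∀ {f x y} → (∀ w → g w ≤ᶠ f w) → adj G x y ≡ true →
                     Compensates G g f x y
  compensates-edge {y = y} g≤f xy = compensates-mono g≤f (record
    { dom   = λ _ gy≡2 → y , xy , gy≡2
    ; total = λ _ gy>0 → y , xy , gy>0
    })

  IsTRDF-deleteEdge : ∀ {G′ u v f} → AddsEdge G u v G′ → IsTRDF G′ g →
                      (∀ w → g w ≤ᶠ f w) →
                      Compensates G g f u v → Compensates G g f v u → IsTRDF G f
  IsTRDF-deleteEdge {G′} {u} {v} {f} G′≡G+uv g-trdf g≤f cu cv = record { dom = dom ; total = total }
    where
    compensates : ∀ {x y} → adj G′ x y ≡ true → Compensates G g f x y
    compensates {x} {y} xy with addEdge-cases G′≡G+uv xy
    ... | inj₁ xy∈G                = compensates-edge g≤f xy∈G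
    ... | inj₂ (inj₁ (refl , refl)) = cu
    ... | inj₂ (inj₂ (refl , refl)) = cv

    dom₀ : ∀ x → toℕ (g x) ≡ 0 → ∃ λ y → adj G x y ≡ true × toℕ (f y) ≡ 2
    dom₀ x gx≡0 = let y , xy , gy≡2 = IsTRDF.dom g-trdf x gx≡0
                  in Compensates.dom (compensates xy) gx≡0 gy≡2

    dom : ∀ x → toℕ (f x) ≡ 0 → ∃ λ y → adj G x y ≡ true × toℕ (f y) ≡ 2
    dom x fx≡0 = dom₀ x (ℕ.n≤0⇒n≡0 (subst (toℕ (g x) ≤_) fx≡0 (g≤f x)))

    total : ∀ x → 0 < toℕ (f x) → ∃ λ y → adj G x y ≡ true × 0 < toℕ (f y)
    total x _ with toℕ (g x) ℕ.≟ 0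
    ... | yes gx≡0 = let y , xy , fy≡2 = dom₀ x gx≡0 in y , xy , subst (0 <_) (sym fy≡2) (s≤s z≤n)
    ... | no gx≢0  = let y , xy , gy>0 = IsTRDF.total g-trdf x (ℕ.n≢0⇒n>0 gx≢0)
                     in Compensates.total (compensates xy) (ℕ.n≢0⇒n>0 gx≢0) gy>0

-- demand a b : the label a G-neighbour of x must carry so that x, with
-- label a, no longer needs its edge to a vertex with label b.
demand : Fin 3 → Fin 3 → Fin 3
demand zero    (suc (suc zero)) = suc (suc zero)
demand (suc _) (suc _)          = suc zero
demand _       _                = zero

demand-dom : ∀ a b → toℕ a ≡ 0 → toℕ b ≡ 2 → toℕ (demand a b) ≡ 2
demand-dom zero (suc (suc zero)) _ _ = refl

demand-total : ∀ a b → 0 < toℕ a → 0 < toℕ b → 0 < toℕ (demand a b)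
demand-total (suc _) (suc _) _ _ = s≤s z≤n

demand-sum : ∀ a b → toℕ (demand a b) + toℕ (demand b a) ≤ 2
demand-sum zero             zero             = z≤n
demand-sum zero             (suc zero)       = z≤n
demand-sum zero             (suc (suc zero)) = ℕ.≤-refl
demand-sum (suc zero)       zero             = z≤n
demand-sum (suc (suc zero)) zero             = ℕ.≤-refl
demand-sum (suc _)          (suc _)          = ℕ.≤-refl

raiseTo : Fin 3 → Fin 3 → Fin 3
raiseTo zero             a    = a
raiseTo (suc zero)       zero = suc zero
raiseTo (suc zero)       a    = a
raiseTo (suc (suc zero)) _    = suc (suc zero)

raiseTo-≥ˡ : ∀ d a → d ≤ᶠ raiseTo d a
raiseTo-≥ˡ zero             a       = z≤n
raiseTo-≥ˡ (suc zero)       zero    = ℕ.≤-refl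
raiseTo-≥ˡ (suc zero)       (suc a) = s≤s z≤n
raiseTo-≥ˡ (suc (suc zero)) _       = ℕ.≤-refl

raiseTo-≥ʳ : ∀ d a → a ≤ᶠ raiseTo d a
raiseTo-≥ʳ zero             a       = ℕ.≤-refl
raiseTo-≥ʳ (suc zero)       zero    = z≤n
raiseTo-≥ʳ (suc zero)       (suc a) = ℕ.≤-refl
raiseTo-≥ʳ (suc (suc zero)) a       = Fin.toℕ≤pred[n] a

raiseTo-≤ : ∀ d a → toℕ (raiseTo d a) ≤ toℕ a + toℕ d
raiseTo-≤ zero             a       = ℕ.m≤m+n (toℕ a) 0
raiseTo-≤ (suc zero)       zero    = ℕ.≤-refl
raiseTo-≤ (suc zero)       (suc a) = ℕ.m≤m+n (toℕ (suc a)) 1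
raiseTo-≤ (suc (suc zero)) a       = ℕ.m≤n+m 2 (toℕ a)

updateAt-inflationary : ∀ {A : Set} (_≼_ : A → A → Set) → (∀ {a} → a ≼ a) →
                        ∀ (h : Vector A n) w {φ} → (∀ a → a ≼ φ a) →
                        ∀ x → h x ≼ updateAt h w φ x
updateAt-inflationary _ refl′ h zero    φ↑ zero    = φ↑ (h zero)
updateAt-inflationary _ refl′ h zero    φ↑ (suc x) = refl′
updateAt-inflationary _ refl′ h (suc w) φ↑ zero    = refl′
updateAt-inflationary _≼_ refl′ h (suc w) φ↑ (suc x) =
  updateAt-inflationary _≼_ refl′ (h ∘ suc) w φ↑ x

sum-tabulate-updateAt : ∀ {A : Set} (c : A → ℕ) (h : Vector A n) w {φ} t →
                        (∀ a → c (φ a) ≤ c a + t) →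
                        sum (tabulate (c ∘ updateAt h w φ)) ≤ sum (tabulate (c ∘ h)) + t
sum-tabulate-updateAt c h zero {φ} t φ≤ = begin
  c (φ (h zero)) + rest      ≤⟨ ℕ.+-monoˡ-≤ rest (φ≤ (h zero)) ⟩
  c (h zero) + t + rest       ≡⟨ ℕ.+-assoc (c (h zero)) t rest ⟩
  c (h zero) + (t + rest)     ≡⟨ cong (c (h zero) +_) (ℕ.+-comm t rest) ⟩
  c (h zero) + (rest + t)     ≡⟨ ℕ.+-assoc (c (h zero)) rest t ⟨
  c (h zero) + rest + t       ∎
  where
  open ℕ.≤-Reasoning
  rest = sum (tabulate (c ∘ h ∘ suc))
sum-tabulate-updateAt c h (suc w) {φ} t φ≤ = begin
  c (h zero) + sum (tabulate (c ∘ updateAt (h ∘ suc) w φ))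
    ≤⟨ ℕ.+-monoʳ-≤ (c (h zero)) (sum-tabulate-updateAt c (h ∘ suc) w t φ≤) ⟩
  c (h zero) + (sum (tabulate (c ∘ h ∘ suc)) + t)
    ≡⟨ ℕ.+-assoc (c (h zero)) _ t ⟨
  c (h zero) + sum (tabulate (c ∘ h ∘ suc)) + t ∎
  where open ℕ.≤-Reasoning

weight-updateAt : ∀ (h : Fin n → Fin 3) w {φ} t → (∀ a → toℕ (φ a) ≤ toℕ a + t) →
                  weight (updateAt h w φ) ≤ weight h + t
weight-updateAt h w {φ} t φ≤
  rewrite map-tabulate id (toℕ ∘ updateAt h w φ) | map-tabulate id (toℕ ∘ h) =
  sum-tabulate-updateAt toℕ h w t φ≤

compensates-raise : ∀ {G : Graph n} {g h : Fin n → Fin 3} {x y w} → adj G x w ≡ true →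
                    Compensates G g (updateAt h w (raiseTo (demand (g x) (g y)))) x y
compensates-raise {g = g} {h} {x} {y} {w} xw = record
  { dom   = λ gx≡0 gy≡2 → w , xw , label≡2-mono d≤fw (demand-dom (g x) (g y) gx≡0 gy≡2)
  ; total = λ gx>0 gy>0 → w , xw , ℕ.<-≤-trans (demand-total (g x) (g y) gx>0 gy>0) d≤fw
  }
  where
  d = demand (g x) (g y)
  d≤fw : d ≤ᶠ updateAt h w (raiseTo d) w
  d≤fw = subst (d ≤ᶠ_) (sym (updateAt-updates w h)) (raiseTo-≥ˡ d (h w))

IsTRDF-deleteEdge-≤+2 : ∀ {G G′ : Graph n} {u v g} → NoIsolated G → AddsEdge G u v G′ →
                        IsTRDF G′ g → Σ (Fin n → Fin 3) λ f → IsTRDF G f × weight f ≤ weight g + 2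
IsTRDF-deleteEdge-≤+2 {u = u} {v} {g} noIso G′≡G+uv g-trdf =
  f , IsTRDF-deleteEdge G′≡G+uv g-trdf g≤f cu cv , weight-f
  where
  wu = proj₁ (noIso u)
  wv = proj₁ (noIso v)
  du = demand (g u) (g v)
  dv = demand (g v) (g u)
  f₁ = updateAt g wu (raiseTo du)
  f = updateAt f₁ wv (raiseTo dv)

  f₁≤f : ∀ x → f₁ x ≤ᶠ f x
  f₁≤f = updateAt-inflationary _≤ᶠ_ Fin.≤-refl f₁ wv (raiseTo-≥ʳ dv)

  g≤f : ∀ x → g x ≤ᶠ f x
  g≤f x = Fin.≤-trans (updateAt-inflationary _≤ᶠ_ Fin.≤-refl g wu (raiseTo-≥ʳ du) x) (f₁≤f x)

  cu : Compensates _ g f u v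
  cu = compensates-mono f₁≤f (compensates-raise (proj₂ (noIso u)))

  cv : Compensates _ g f v u
  cv = compensates-raise (proj₂ (noIso v))

  weight-f : weight f ≤ weight g + 2
  weight-f = begin
    weight f                        ≤⟨ weight-updateAt f₁ wv (toℕ dv) (raiseTo-≤ dv) ⟩
    weight f₁ + toℕ dv              ≤⟨ ℕ.+-monoˡ-≤ (toℕ dv) (weight-updateAt g wu (toℕ du) (raiseTo-≤ du)) ⟩
    weight g + toℕ du + toℕ dv      ≡⟨ ℕ.+-assoc (weight g) (toℕ du) (toℕ dv) ⟩
    weight g + (toℕ du + toℕ dv)    ≤⟨ ℕ.+-monoʳ-≤ (weight g) (demand-sum (g u) (g v)) ⟩
    weight g + 2                    ∎
    where open ℕ.≤-Reasoning

mainTheorem6 : ∀ {n} (G : Graph n) → NoIsolated G →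
    ∀ (u v : Fin n) → ¬ (u ≡ v) → adj G u v ≡ false →
    (G+uv : Graph n) → (∀ x y → adj G+uv x y ≡ addEdgeAdj G u v x y) →
    ∀ (k k′ : ℕ) → IsTRDomNumber G k → IsTRDomNumber G+uv k′ →
    k ≤ k′ + 2 × k′ ≤ k
mainTheorem6 G noIso u v _ _ G+uv G+uv-adj _ _
  ((f , f-trdf , refl) , γ-min) ((g , g-trdf , refl) , γ′-min) =
  lower , γ′-min f (IsTRDF-⊆ (addEdge-⊇ G+uv-def) f-trdf)
  where
  G+uv-def : AddsEdge G u v G+uv
  G+uv-def = addsEdge G+uv-adj

  lower : weight f ≤ weight g + 2
  lower with IsTRDF-deleteEdge-≤+2 noIso G+uv-def g-trdf
  ... | f₀ , f₀-trdf , f₀≤g+2 = ℕ.≤-trans (γ-min f₀ f₀-trdf) f₀≤g+2
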